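{- Let $G$ be a twin-free, cubic graph, let $M$ be a maximum matching of $G$, and let $D\in\mathcal{D}_G(M)$. Then for every $D$-bad pair $\{u,v\}$, both $u$ and $v$ are $2$-dominated by $D$, i.e. $|N(u)\cap D| = |N(v)\cap D| = 2$.
   Context: All graphs are finite and simple; a cubic graph is one in which every vertex has degree $3$. $N(v)$ and $N[v]=N(v)\cup\{v\}$ denote the open and closed neighborhoods of $v$. Distinct vertices $u,v$ are twins if $N(u)=N(v)$ or $N[u]=N[v]$; $G$ is twin-free if it has no twins. A matching is a set of pairwise disjoint edges; a maximum matching is one of maximum cardinality. Given a matching $M$, a vertex is $M$-matched if incident with an edge of $M$, and $M$-unmatched otherwise. For a maximum matching $M$ of $G$, $\mathcal{D}_G(M)$ is the collection of all sets $D\subseteq V(G)$ such that: (i) for every edge $uv\in M$, if exactly one of $u$ and $v$ has an $M$-unmatched neighbor, then the vertex of $\{u,v\}$ having an $M$-unmatched neighbor belongs to $D$; (ii) for every edge $uv\in M$, if neither $u$ nor $v$ has an $M$-unmatched neighbor, or if $u$ and $v$ have a common $M$-unmatched neighbor, then exactly one of $u$ and $v$ belongs to $D$. Given $D\subseteq V(G)$, a $D$-bad pair is a pair of distinct vertices $u,v\in V(G)\setminus D$ with $N(u)\cap D = N(v)\cap D$. -}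

module Defs where

open import Data.Nat using (ℕ; _≤_; _<ᵇ_)
open import Data.Bool using (Bool; true; false; _∧_)
open import Data.Fin using (Fin; toℕ)
open import Data.Fin.Subset using (Subset; _∈_; _∉_; _∩_; _∪_; ⁅_⁆; ∣_∣)
open import Data.Vec using (tabulate)
open import Data.List using (map; allFin)
open import Data.Nat.ListAction using (sum)
open import Data.Product using (Σ; ∃; _×_)
open import Data.Sum using (_⊎_)
open import Relation.Nullary using (¬_)
open import Relation.Binary.PropositionalEquality using (_≡_; _≢_)

record Graph (n : ℕ) : Set where
  field
    adj    : Fin n → Fin n → Bool
    sym    : ∀ u v → adj u v ≡ adj v u
    irrefl : ∀ v → adj v v ≡ false
open Graph public

module _ {n : ℕ} (G : Graph n) where

  Adjacent : Fin n → Fin n → Set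
  Adjacent u v = adj G u v ≡ true

  N : Fin n → Subset n
  N v = tabulate (adj G v)

  N[_] : Fin n → Subset n
  N[ v ] = N v ∪ ⁅ v ⁆

  Cubic : Set
  Cubic = ∀ v → ∣ N v ∣ ≡ 3

  TwinFree : Set
  TwinFree = ∀ u v → u ≢ v → (N u ≢ N v) × (N[ u ] ≢ N[ v ])

  record IsMatching (mat : Fin n → Fin n → Bool) : Set where
    field
      edge   : ∀ u v → mat u v ≡ true → Adjacent u v
      msym   : ∀ u v → mat u v ≡ mat v u
      unique : ∀ u v w → mat u v ≡ true → mat u w ≡ true → v ≡ w

  -- number of edges of the matching (unordered pairs, counted with u < v)
  matchingSize : (Fin n → Fin n → Bool) → ℕ
  matchingSize mat =
    sum (map (λ u → ∣ tabulate (λ v → mat u v ∧ (toℕ u <ᵇ toℕ v)) ∣) (allFin n))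

  IsMaximumMatching : (Fin n → Fin n → Bool) → Set
  IsMaximumMatching mat =
    IsMatching mat × (∀ mat' → IsMatching mat' → matchingSize mat' ≤ matchingSize mat)

  module _ (mat : Fin n → Fin n → Bool) where

    Matched : Fin n → Set
    Matched u = ∃ λ v → mat u v ≡ true

    Unmatched : Fin n → Set
    Unmatched u = ¬ Matched u

    HasUnmatchedNbr : Fin n → Set
    HasUnmatchedNbr u = ∃ λ w → Adjacent u w × Unmatched w

    CommonUnmatchedNbr : Fin n → Fin n → Set
    CommonUnmatchedNbr u v = ∃ λ w → Adjacent u w × Adjacent v w × Unmatched w

    -- D ∈ 𝒟_G(M)   (M is assumed to be a maximum matching separately)
    InDSet : Subset n → Set
    InDSet D =
      (∀ u v → mat u v ≡ true →
         HasUnmatchedNbr u → ¬ HasUnmatchedNbr v → u ∈ D)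
      × (∀ u v → mat u v ≡ true →
         ((¬ HasUnmatchedNbr u × ¬ HasUnmatchedNbr v) ⊎ CommonUnmatchedNbr u v) →
         ((u ∈ D × v ∉ D) ⊎ (u ∉ D × v ∈ D)))

  BadPair : Subset n → Fin n → Fin n → Set
  BadPair D u v = u ≢ v × u ∉ D × v ∉ D × (N u ∩ D ≡ N v ∩ D)

-- A maximum matching M has no augmenting path of length 1 or 3 (otherwise swapping along it
-- gives a larger matching). Together with the rules defining D this yields: the M-partner of a
-- vertex outside D lies in D, and an M-unmatched vertex a has at most one neighbour outside D:
-- each such neighbour is matched to a vertex of N(a) ∩ D, distinct ones to distinct vertices,
-- and |N(a)| = 3.
-- So for a bad pair {u, v}, |N(u) ∩ D| ≥ 2: if u, v are both matched, their distinct partners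
-- lie in N(u) ∩ D = N(v) ∩ D. And |N(u) ∩ D| ≠ 3, since otherwise N(u) = N(u) ∩ D = N(v) ∩ D
-- = N(v) and u, v would be twins.
module Submission where

open import Defs hiding (sym)
open import Data.Nat using (ℕ; suc; _+_; _≤_; _<_; z≤n; s≤s; _<ᵇ_)
open import Data.Nat.Properties
  using (≤-trans; ≤-reflexive; 1+n≰n; ≤-antisym; ≤-pred; ≤∧≢⇒<; +-suc; +-comm; +-mono-≤; +-monoʳ-≤;
         <-asym; <-cmp; ≤⇒≯; <ᵇ⇒<; <⇒<ᵇ; suc-injective)
open import Data.Bool using (Bool; true; false; _∧_)
import Data.Bool.Properties as Bool
open import Data.Fin using (Fin; zero; suc; toℕ; _≟_)
import Data.Fin.Properties as Fin
open import Data.Fin.Subset using (Subset; _∈_; _∉_; _∩_; ∁; ∣_∣; inside; outside)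
open import Data.Fin.Subset.Properties
  using (x∈p⇒∣p-x∣<∣p∣; x∈p∧x≢y⇒x∈p-y; Empty-unique; ∣⊥∣≡0; ∣p∩q∣≤∣p∣; x∈p∩q⁺; x∈p∩q⁻; x∈∁p⇒x∉p)
open import Data.Vec using ([]; _∷_; tabulate; here; there)
import Data.Vec.Properties as Vec
import Data.List as List
import Data.List.Properties as List
open import Data.Nat.ListAction using (sum)
open import Data.Product using (∃; _×_; _,_; proj₁; proj₂)
open import Data.Sum using (_⊎_; inj₁; inj₂)
open import Data.Empty using (⊥; ⊥-elim)
open import Function using (_∘_; Equivalence)
open import Relation.Nullary using (¬_; Dec; yes; no; contradiction)
open import Relation.Nullary.Decidable using (_×-dec_; _⊎-dec_; ¬?)
open import Relation.Binary using (tri<; tri≈; tri>)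
open import Relation.Binary.PropositionalEquality

private
  variable
    n : ℕ
    s t a b c p q u v w w′ x x′ y : Fin n
    m m′ : Fin n → Fin n → Bool
    β γ : Bool

x∈p⇒0<∣p∣ : ∀ {p : Subset n} {x} → x ∈ p → 0 < ∣ p ∣
x∈p⇒0<∣p∣ x∈p = ≤-trans (s≤s z≤n) (x∈p⇒∣p-x∣<∣p∣ x∈p)

x,y∈p⇒1<∣p∣ : ∀ {p : Subset n} {x y} → x ≢ y → x ∈ p → y ∈ p → 1 < ∣ p ∣
x,y∈p⇒1<∣p∣ x≢y x∈p y∈p =
  ≤-trans (s≤s (x∈p⇒0<∣p∣ (x∈p∧x≢y⇒x∈p-y y∈p (x≢y ∘ sym)))) (x∈p⇒∣p-x∣<∣p∣ x∈p)

∣p∣≤1 : ∀ (p : Subset n) → (∀ {x y} → x ∈ p → y ∈ p → x ≡ y) → ∣ p ∣ ≤ 1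
∣p∣≤1 [] _ = z≤n
∣p∣≤1 (outside ∷ p) unique = ∣p∣≤1 p (λ x∈p y∈p → Fin.suc-injective (unique (there x∈p) (there y∈p)))
∣p∣≤1 {suc k} (inside ∷ p) unique = s≤s (≤-reflexive (trans (cong ∣_∣ (Empty-unique empty)) (∣⊥∣≡0 k)))
  where
  empty : ¬ ∃ λ x → x ∈ p
  empty (x , x∈p) with unique here (there x∈p)
  ... | ()

∣p∣≡∣p∩q∣+∣p∩∁q∣ : ∀ (p q : Subset n) → ∣ p ∣ ≡ ∣ p ∩ q ∣ + ∣ p ∩ ∁ q ∣
∣p∣≡∣p∩q∣+∣p∩∁q∣ [] [] = refl
∣p∣≡∣p∩q∣+∣p∩∁q∣ (outside ∷ p) (_ ∷ q) = ∣p∣≡∣p∩q∣+∣p∩∁q∣ p q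
∣p∣≡∣p∩q∣+∣p∩∁q∣ (inside ∷ p) (inside ∷ q) = cong suc (∣p∣≡∣p∩q∣+∣p∩∁q∣ p q)
∣p∣≡∣p∩q∣+∣p∩∁q∣ (inside ∷ p) (outside ∷ q) = trans (cong suc (∣p∣≡∣p∩q∣+∣p∩∁q∣ p q)) (sym (+-suc _ _))

∣p∩q∣≡∣p∣⇒p∩q≡p : ∀ (p q : Subset n) → ∣ p ∩ q ∣ ≡ ∣ p ∣ → p ∩ q ≡ p
∣p∩q∣≡∣p∣⇒p∩q≡p [] [] _ = refl
∣p∩q∣≡∣p∣⇒p∩q≡p (outside ∷ p) (_ ∷ q) e = cong (outside ∷_) (∣p∩q∣≡∣p∣⇒p∩q≡p p q e)
∣p∩q∣≡∣p∣⇒p∩q≡p (inside ∷ p) (inside ∷ q) e = cong (inside ∷_) (∣p∩q∣≡∣p∣⇒p∩q≡p p q (suc-injective e))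
∣p∩q∣≡∣p∣⇒p∩q≡p (inside ∷ p) (outside ∷ q) e = contradiction (≤-reflexive (sym e)) (≤⇒≯ (∣p∩q∣≤∣p∣ p q))

∣∷∣-suc : ∀ β (p q : Subset n) → ∣ p ∣ ≡ suc ∣ q ∣ → ∣ β ∷ p ∣ ≡ suc ∣ β ∷ q ∣
∣∷∣-suc true  _ _ e = cong suc e
∣∷∣-suc false _ _ e = e

∣tabulate∣-insert : ∀ (f g : Fin n → Bool) t → (∀ v → v ≢ t → f v ≡ g v) → f t ≡ false → g t ≡ true →
                    ∣ tabulate g ∣ ≡ suc ∣ tabulate f ∣
∣tabulate∣-insert f g zero agree ft gt rewrite ft | gt =
  cong suc (cong ∣_∣ (Vec.tabulate-cong (λ v → sym (agree (suc v) λ ()))))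
∣tabulate∣-insert f g (suc t) agree ft gt =
  trans (cong (λ β → ∣ β ∷ tabulate (g ∘ suc) ∣) (sym (agree zero λ ())))
        (∣∷∣-suc (f zero) (tabulate (g ∘ suc)) (tabulate (f ∘ suc))
           (∣tabulate∣-insert (f ∘ suc) (g ∘ suc) t (λ v v≢t → agree (suc v) (v≢t ∘ Fin.suc-injective)) ft gt))

sum-tabulate-insert : ∀ (F G : Fin n → ℕ) s → (∀ u → u ≢ s → F u ≡ G u) → G s ≡ suc (F s) →
                      sum (List.tabulate G) ≡ suc (sum (List.tabulate F))
sum-tabulate-insert F G zero agree e =
  cong₂ _+_ e (cong sum (List.tabulate-cong (λ u → sym (agree (suc u) λ ()))))
sum-tabulate-insert F G (suc s) agree e =
  trans (cong₂ _+_ (sym (agree zero λ ()))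
                   (sum-tabulate-insert (F ∘ suc) (G ∘ suc) s (λ u u≢s → agree (suc u) (u≢s ∘ Fin.suc-injective)) e))
        (+-suc _ _)

<⇒≯ᵇ : ∀ {i j} → i < j → (j <ᵇ i) ≡ false
<⇒≯ᵇ {i} {j} i<j = Bool.¬-not (λ j<ᵇi → <-asym i<j (<ᵇ⇒< j i (Equivalence.from Bool.T-≡ j<ᵇi)))

<⇒<ᵇ≡true : ∀ {i j} → i < j → (i <ᵇ j) ≡ true
<⇒<ᵇ≡true i<j = Equivalence.to Bool.T-≡ (<⇒<ᵇ i<j)

SameEdge : Fin n → Fin n → Fin n → Fin n → Set
SameEdge s t a b = (a ≡ s × b ≡ t) ⊎ (a ≡ t × b ≡ s)

sameEdge? : ∀ (s t a b : Fin n) → Dec (SameEdge s t a b)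
sameEdge? s t a b = ((a ≟ s) ×-dec (b ≟ t)) ⊎-dec ((a ≟ t) ×-dec (b ≟ s))

SameEdge-flip : SameEdge s t a b → SameEdge s t b a
SameEdge-flip (inj₁ (a≡s , b≡t)) = inj₂ (b≡t , a≡s)
SameEdge-flip (inj₂ (a≡t , b≡s)) = inj₁ (b≡s , a≡t)

SameEdge-swap : SameEdge s t a b → SameEdge t s a b
SameEdge-swap (inj₁ e) = inj₂ e
SameEdge-swap (inj₂ e) = inj₁ e

SameEdge-functional : s ≢ t → SameEdge s t a b → SameEdge s t a c → b ≡ c
SameEdge-functional s≢t (inj₁ (_ , refl)) (inj₁ (_ , refl)) = refl
SameEdge-functional s≢t (inj₂ (_ , refl)) (inj₂ (_ , refl)) = refl
SameEdge-functional s≢t (inj₁ (refl , _)) (inj₂ (a≡t , _)) = contradiction a≡t s≢t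
SameEdge-functional s≢t (inj₂ (refl , _)) (inj₁ (a≡s , _)) = contradiction (sym a≡s) s≢t

record EdgeUpdate (m : Fin n → Fin n → Bool) (s t : Fin n) (β : Bool) (m′ : Fin n → Fin n → Bool) : Set where
  field
    on-edge  : ∀ {a b} → SameEdge s t a b → m′ a b ≡ β
    off-edge : ∀ {a b} → ¬ SameEdge s t a b → m′ a b ≡ m a b
open EdgeUpdate

_[_─_]≔_ : (Fin n → Fin n → Bool) → Fin n → Fin n → Bool → Fin n → Fin n → Bool
(m [ s ─ t ]≔ β) a b with sameEdge? s t a b
... | yes _ = β
... | no _  = m a b

[─]≔-edgeUpdate : ∀ m (s t : Fin n) β → EdgeUpdate m s t β (m [ s ─ t ]≔ β)
[─]≔-edgeUpdate m s t β = record { on-edge = on ; off-edge = off }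
  where
  on : ∀ {a b} → SameEdge s t a b → (m [ s ─ t ]≔ β) a b ≡ β
  on {a} {b} st with sameEdge? s t a b
  ... | yes _  = refl
  ... | no ¬st = contradiction st ¬st
  off : ∀ {a b} → ¬ SameEdge s t a b → (m [ s ─ t ]≔ β) a b ≡ m a b
  off {a} {b} ¬st with sameEdge? s t a b
  ... | yes st = contradiction st ¬st
  ... | no _   = refl

update-true⁻ : EdgeUpdate m s t β m′ → ∀ a b → m′ a b ≡ true →
               (SameEdge s t a b × β ≡ true) ⊎ (¬ SameEdge s t a b × m a b ≡ true)
update-true⁻ {s = s} {t = t} upd a b e with sameEdge? s t a b
... | yes st = inj₁ (st , trans (sym (on-edge upd st)) e)
... | no ¬st = inj₂ (¬st , trans (sym (off-edge upd ¬st)) e)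

removal-true⁻ : EdgeUpdate m s t false m′ → ∀ a b → m′ a b ≡ true → ¬ SameEdge s t a b × m a b ≡ true
removal-true⁻ upd a b e with update-true⁻ upd a b e
... | inj₁ (_ , ())
... | inj₂ kept = kept

update-sym : EdgeUpdate m s t β m′ → (∀ a b → m a b ≡ m b a) → ∀ a b → m′ a b ≡ m′ b a
update-sym {s = s} {t = t} upd msym a b with sameEdge? s t a b
... | yes st = trans (on-edge upd st) (sym (on-edge upd (SameEdge-flip st)))
... | no ¬st = trans (off-edge upd ¬st) (trans (msym a b) (sym (off-edge upd (¬st ∘ SameEdge-flip))))

update-revert : EdgeUpdate m s t β m′ → (∀ {a b} → SameEdge s t a b → m a b ≡ γ) → EdgeUpdate m′ s t γ m
update-revert upd old = record { on-edge = old ; off-edge = λ ¬st → sym (off-edge upd ¬st) }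

module _ (G : Graph n) where

  private
    upper : (Fin n → Fin n → Bool) → Fin n → Fin n → Bool
    upper m u v = m u v ∧ (toℕ u <ᵇ toℕ v)

    matchingSize-upper : ∀ m → matchingSize G m ≡ sum (List.tabulate (λ u → ∣ tabulate (upper m u) ∣))
    matchingSize-upper m = cong sum (List.map-tabulate (λ u → u) (λ u → ∣ tabulate (upper m u) ∣))

    -- matchingSize counts each edge once, at its entry above the diagonal, so inserting
    -- the edge {s, t} with s < t changes exactly one counted entry: (s, t).
    insertion-size< : toℕ s < toℕ t → EdgeUpdate m s t true m′ → m s t ≡ false →
                      matchingSize G m′ ≡ suc (matchingSize G m)
    insertion-size< {s} {t} {m} {m′} s<t upd mst =
      trans (matchingSize-upper m′)
        (trans (sum-tabulate-insert _ _ s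
                  (λ u u≢s → cong ∣_∣ (Vec.tabulate-cong (λ v → upper-agree u v (u≢s ∘ proj₁))))
                  (∣tabulate∣-insert _ _ t (λ v v≢t → upper-agree s v (v≢t ∘ proj₂))
                     (cong (_∧ _) mst)
                     (trans (cong (_∧ _) (on-edge upd (inj₁ (refl , refl)))) (<⇒<ᵇ≡true s<t))))
               (cong suc (sym (matchingSize-upper m))))
      where
      upper-agree : ∀ u v → ¬ (u ≡ s × v ≡ t) → upper m u v ≡ upper m′ u v
      upper-agree u v ¬st with sameEdge? s t u v
      ... | no ¬e = cong (_∧ _) (sym (off-edge upd ¬e))
      ... | yes (inj₁ st) = contradiction st ¬st
      ... | yes (inj₂ (refl , refl)) rewrite <⇒≯ᵇ s<t = trans (Bool.∧-zeroʳ _) (sym (Bool.∧-zeroʳ _))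

  insertion-size : s ≢ t → EdgeUpdate m s t true m′ → (∀ {a b} → SameEdge s t a b → m a b ≡ false) →
                   matchingSize G m′ ≡ suc (matchingSize G m)
  insertion-size {s} {t} {m} {m′} s≢t upd old with <-cmp (toℕ s) (toℕ t)
  ... | tri< s<t _ _ = insertion-size< s<t upd (old (inj₁ (refl , refl)))
  ... | tri≈ _ s≡t _ = contradiction (Fin.toℕ-injective s≡t) s≢t
  ... | tri> _ _ t<s = insertion-size< t<s upd′ (old (inj₂ (refl , refl)))
    where
    upd′ : EdgeUpdate m t s true m′
    upd′ = record { on-edge = on-edge upd ∘ SameEdge-swap ; off-edge = λ ¬st → off-edge upd (¬st ∘ SameEdge-swap) }

  adjacent-sym : Adjacent G a b → Adjacent G b a
  adjacent-sym {a = a} {b = b} e = trans (Graph.sym G b a) e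

  adjacent⇒≢ : Adjacent G a b → a ≢ b
  adjacent⇒≢ {a = a} e refl with trans (sym e) (irrefl G a)
  ... | ()

  ∈N⇒adjacent : b ∈ N G a → Adjacent G a b
  ∈N⇒adjacent {b = b} {a = a} b∈N = trans (sym (Vec.lookup∘tabulate (adj G a) b)) (Vec.[]=⇒lookup b∈N)

  adjacent⇒∈N : Adjacent G a b → b ∈ N G a
  adjacent⇒∈N {a = a} {b = b} e = Vec.lookup⇒[]= b (N G a) (trans (Vec.lookup∘tabulate (adj G a) b) e)

  unmatched⇒false : Unmatched G m a → ∀ b → m a b ≡ false
  unmatched⇒false unm b = Bool.¬-not (λ e → unm (b , e))

  unmatched⇒≢matched : Unmatched G m a → m b c ≡ true → a ≢ b
  unmatched⇒≢matched unm e refl = unm (_ , e)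

  removal-isMatching : IsMatching G m → EdgeUpdate m s t false m′ → IsMatching G m′
  removal-isMatching {m = m} {m′ = m′} isM upd = record
    { edge   = λ a b e → edge a b (kept a b e)
    ; msym   = update-sym upd msym
    ; unique = λ a b c e₁ e₂ → unique a b c (kept a b e₁) (kept a c e₂)
    }
    where
    open IsMatching isM
    kept : ∀ a b → m′ a b ≡ true → m a b ≡ true
    kept a b e = proj₂ (removal-true⁻ upd a b e)

  insertion-isMatching : IsMatching G m → Adjacent G s t → Unmatched G m s → Unmatched G m t →
                         EdgeUpdate m s t true m′ → IsMatching G m′
  insertion-isMatching {m = m} {s = s} {t = t} {m′ = m′} isM st s-unm t-unm upd =
    record { edge = edge′ ; msym = update-sym upd msym ; unique = unique′ }
    where
    open IsMatching isM
    endpoint-unmatched : SameEdge s t a b → Unmatched G m a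
    endpoint-unmatched (inj₁ (refl , _)) = s-unm
    endpoint-unmatched (inj₂ (refl , _)) = t-unm
    edge′ : ∀ a b → m′ a b ≡ true → Adjacent G a b
    edge′ a b e with update-true⁻ upd a b e
    ... | inj₁ (inj₁ (refl , refl) , _) = st
    ... | inj₁ (inj₂ (refl , refl) , _) = adjacent-sym st
    ... | inj₂ (_ , ab) = edge a b ab
    unique′ : ∀ a b c → m′ a b ≡ true → m′ a c ≡ true → b ≡ c
    unique′ a b c e₁ e₂ with update-true⁻ upd a b e₁ | update-true⁻ upd a c e₂
    ... | inj₁ (e , _)  | inj₁ (e′ , _) = SameEdge-functional (adjacent⇒≢ st) e e′
    ... | inj₁ (e , _)  | inj₂ (_ , ac) = contradiction (c , ac) (endpoint-unmatched e)
    ... | inj₂ (_ , ab) | inj₁ (e , _)  = contradiction (b , ab) (endpoint-unmatched e)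
    ... | inj₂ (_ , ab) | inj₂ (_ , ac) = unique a b c ab ac

  removal-unmatched : EdgeUpdate m s t false m′ → Unmatched G m a → Unmatched G m′ a
  removal-unmatched upd unm (b , e) = unm (b , proj₂ (removal-true⁻ upd _ b e))

  removal-unmatches : IsMatching G m → EdgeUpdate m s t false m′ → SameEdge s t a c → m a c ≡ true →
                      Unmatched G m′ a
  removal-unmatches isM upd st ac (b , e) with removal-true⁻ upd _ b e
  ... | ¬st , ab with IsMatching.unique isM _ _ _ ab ac
  ... | refl = ¬st st

  insertion-unmatched : EdgeUpdate m s t β m′ → Unmatched G m a → a ≢ s → a ≢ t → Unmatched G m′ a
  insertion-unmatched upd unm a≢s a≢t (b , e) with update-true⁻ upd _ b e
  ... | inj₁ (inj₁ (a≡s , _) , _) = a≢s a≡s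
  ... | inj₁ (inj₂ (a≡t , _) , _) = a≢t a≡t
  ... | inj₂ (_ , ab) = unm (b , ab)

  maximum-not-improvable : IsMaximumMatching G m → IsMatching G m′ →
                           matchingSize G m′ ≢ suc (matchingSize G m)
  maximum-not-improvable {m = m} (_ , maximal) isM′ e =
    1+n≰n (subst (_≤ matchingSize G m) e (maximal _ isM′))

  insertion-size-unmatched : Adjacent G s t → Unmatched G m s → Unmatched G m t →
                             EdgeUpdate m s t true m′ → matchingSize G m′ ≡ suc (matchingSize G m)
  insertion-size-unmatched {s = s} {t = t} {m = m} st s-unm t-unm upd =
    insertion-size (adjacent⇒≢ st) upd λ { (inj₁ (refl , refl)) → unmatched⇒false {m = m} s-unm t
                                         ; (inj₂ (refl , refl)) → unmatched⇒false {m = m} t-unm s }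

  removal-size : IsMatching G m → m s t ≡ true → EdgeUpdate m s t false m′ →
                 matchingSize G m ≡ suc (matchingSize G m′)
  removal-size {m = m} {s = s} {t = t} isM st upd =
    insertion-size (adjacent⇒≢ (edge s t st))
      (update-revert upd λ { (inj₁ (refl , refl)) → st ; (inj₂ (refl , refl)) → trans (msym t s) st })
      (on-edge upd)
    where open IsMatching isM

  no-augmenting-edge : IsMaximumMatching G m → Adjacent G s t → Unmatched G m s → Unmatched G m t → ⊥
  no-augmenting-edge {m = m} {s = s} {t = t} mm@(isM , _) st s-unm t-unm =
    maximum-not-improvable mm (insertion-isMatching isM st s-unm t-unm upd)
                              (insertion-size-unmatched st s-unm t-unm upd)
    where
    upd : EdgeUpdate m s t true (m [ s ─ t ]≔ true)
    upd = [─]≔-edgeUpdate m s t true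

  no-augmenting-3-path : IsMaximumMatching G m → Unmatched G m p → Unmatched G m q → p ≢ q →
                         Adjacent G p x → m x y ≡ true → Adjacent G y q → ⊥
  no-augmenting-3-path {m = m} {p = p} {q = q} {x = x} {y = y} mm@(isM , _) p-unm q-unm p≢q px xy yq =
    maximum-not-improvable mm isM₂ (begin
      matchingSize G m₂             ≡⟨ insertion-size-unmatched yq y-unm₁ q-unm₁ upd₂ ⟩
      suc (matchingSize G m₁)       ≡⟨ cong suc (insertion-size-unmatched px p-unm₀ x-unm₀ upd₁) ⟩
      suc (suc (matchingSize G m₀)) ≡⟨ cong suc (sym (removal-size isM xy upd₀)) ⟩
      suc (matchingSize G m)        ∎)
    where
    open IsMatching isM
    open ≡-Reasoning
    yx : m y x ≡ true
    yx = trans (msym y x) xy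
    m₀ m₁ m₂ : Fin n → Fin n → Bool
    m₀ = m [ x ─ y ]≔ false
    m₁ = m₀ [ p ─ x ]≔ true
    m₂ = m₁ [ y ─ q ]≔ true
    upd₀ : EdgeUpdate m x y false m₀
    upd₀ = [─]≔-edgeUpdate m x y false
    upd₁ : EdgeUpdate m₀ p x true m₁
    upd₁ = [─]≔-edgeUpdate m₀ p x true
    upd₂ : EdgeUpdate m₁ y q true m₂
    upd₂ = [─]≔-edgeUpdate m₁ y q true
    p-unm₀ : Unmatched G m₀ p
    p-unm₀ = removal-unmatched upd₀ p-unm
    x-unm₀ : Unmatched G m₀ x
    x-unm₀ = removal-unmatches isM upd₀ (inj₁ (refl , refl)) xy
    y-unm₁ : Unmatched G m₁ y
    y-unm₁ = insertion-unmatched upd₁ (removal-unmatches isM upd₀ (inj₂ (refl , refl)) yx)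
               (unmatched⇒≢matched {m = m} p-unm yx ∘ sym) (adjacent⇒≢ (edge x y xy) ∘ sym)
    q-unm₁ : Unmatched G m₁ q
    q-unm₁ = insertion-unmatched upd₁ (removal-unmatched upd₀ q-unm)
               (p≢q ∘ sym) (unmatched⇒≢matched {m = m} q-unm xy)
    isM₂ : IsMatching G m₂
    isM₂ = insertion-isMatching (insertion-isMatching (removal-isMatching isM upd₀) px p-unm₀ x-unm₀ upd₁)
                                yq y-unm₁ q-unm₁ upd₂

m+n≡3∧n≤1⇒2≤m : ∀ {i j} → i + j ≡ 3 → j ≤ 1 → 2 ≤ i
m+n≡3∧n≤1⇒2≤m {i} {j} e j≤1 = ≤-pred (subst (3 ≤_) (+-comm i 1) (subst (_≤ i + 1) e (+-monoʳ-≤ i j≤1)))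

exactly-one-∈⇒ : ∀ {D : Subset n} → (a ∈ D × b ∉ D) ⊎ (a ∉ D × b ∈ D) → a ∉ D → b ∈ D
exactly-one-∈⇒ (inj₁ (a∈D , _)) a∉D = contradiction a∈D a∉D
exactly-one-∈⇒ (inj₂ (_ , b∈D)) _   = b∈D

module _ (G : Graph n) (D : Subset n) where

  BadPair-sym : BadPair G D u v → BadPair G D v u
  BadPair-sym (u≢v , u∉D , v∉D , same) = u≢v ∘ sym , v∉D , u∉D , sym same

  BadPair⇒∣N∩D∣≢3 : TwinFree G → Cubic G → BadPair G D u v → ∣ N G u ∩ D ∣ ≢ 3
  BadPair⇒∣N∩D∣≢3 {u = u} {v = v} twinFree cubic (u≢v , _ , _ , same) e = proj₁ (twinFree u v u≢v) (begin
    N G u     ≡⟨ sym (∣p∩q∣≡∣p∣⇒p∩q≡p (N G u) D (trans e (sym (cubic u)))) ⟩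
    N G u ∩ D ≡⟨ same ⟩
    N G v ∩ D ≡⟨ ∣p∩q∣≡∣p∣⇒p∩q≡p (N G v) D (trans (cong ∣_∣ (sym same)) (trans e (sym (cubic v)))) ⟩
    N G v     ∎)
    where open ≡-Reasoning

module _ (G : Graph n) (mat : Fin n → Fin n → Bool) (mm : IsMaximumMatching G mat) where

  open IsMatching (proj₁ mm)

  matched? : ∀ u → Dec (Matched G mat u)
  matched? u = Fin.any? (λ v → mat u v Bool.≟ true)

  hasUnmatchedNbr? : ∀ u → Dec (HasUnmatchedNbr G mat u)
  hasUnmatchedNbr? u = Fin.any? (λ w → (adj G u w Bool.≟ true) ×-dec ¬? (matched? w))

  mat-sym : mat a b ≡ true → mat b a ≡ true
  mat-sym {a = a} {b = b} ab = trans (msym b a) ab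

  partner-injective : mat a c ≡ true → mat b c ≡ true → a ≡ b
  partner-injective ac bc = unique _ _ _ (mat-sym ac) (mat-sym bc)

  unmatched-nbr-matched : Unmatched G mat a → Adjacent G a b → Matched G mat b
  unmatched-nbr-matched {b = b} a-unm ab with matched? b
  ... | yes b-mat = b-mat
  ... | no b-unm  = ⊥-elim (no-augmenting-edge G mm ab a-unm b-unm)

  unmatched-nbr-unique : Unmatched G mat w → Adjacent G x w → mat x x′ ≡ true →
                         Adjacent G x′ w′ → Unmatched G mat w′ → w′ ≡ w
  unmatched-nbr-unique {w = w} {w′ = w′} w-unm xw xx′ x′w′ w′-unm with w′ ≟ w
  ... | yes w′≡w = w′≡w
  ... | no w′≢w  = ⊥-elim (no-augmenting-3-path G mm w-unm w′-unm (w′≢w ∘ sym) (adjacent-sym G xw) xx′ x′w′)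

  module _ (D : Subset n) (D∈𝒟 : InDSet G mat D) where

    partner∈D : mat a b ≡ true → a ∉ D → b ∈ D
    partner∈D {a = a} {b = b} ab a∉D with hasUnmatchedNbr? a | hasUnmatchedNbr? b
    ... | yes (w , aw , w-unm) | yes (w′ , bw′ , w′-unm) =
      exactly-one-∈⇒ (proj₂ D∈𝒟 a b ab (inj₂ (w , aw , bw , w-unm))) a∉D
      where
      bw : Adjacent G b w
      bw = subst (Adjacent G b) (unmatched-nbr-unique w-unm aw ab bw′ w′-unm) bw′
    ... | yes a-nbr | no ¬b-nbr = contradiction (proj₁ D∈𝒟 a b ab a-nbr ¬b-nbr) a∉D
    ... | no ¬a-nbr | yes b-nbr = proj₁ D∈𝒟 b a (mat-sym ab) b-nbr ¬a-nbr
    ... | no ¬a-nbr | no ¬b-nbr = exactly-one-∈⇒ (proj₂ D∈𝒟 a b ab (inj₁ (¬a-nbr , ¬b-nbr))) a∉D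

    partner∈N∩D : mat a b ≡ true → a ∉ D → b ∈ N G a ∩ D
    partner∈N∩D {a = a} {b = b} ab a∉D = x∈p∩q⁺ (adjacent⇒∈N G (edge a b ab) , partner∈D ab a∉D)

    unmatched-nbr∉D-partner : Unmatched G mat a → Adjacent G a x → x ∉ D →
                              ∃ λ x′ → mat x x′ ≡ true × x′ ∈ N G a ∩ D
    unmatched-nbr∉D-partner {a = a} {x = x} a-unm ax x∉D with unmatched-nbr-matched a-unm ax
    ... | x′ , xx′ with hasUnmatchedNbr? x′
    ...   | no ¬x′-nbr = contradiction (proj₁ D∈𝒟 x x′ xx′ (a , adjacent-sym G ax , a-unm) ¬x′-nbr) x∉D
    ...   | yes (w′ , x′w′ , w′-unm) = x′ , xx′ , x∈p∩q⁺ (adjacent⇒∈N G ax′ , partner∈D xx′ x∉D)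
      where
      ax′ : Adjacent G a x′
      ax′ = adjacent-sym G (subst (Adjacent G x′)
                                  (unmatched-nbr-unique a-unm (adjacent-sym G ax) xx′ x′w′ w′-unm) x′w′)

    unmatched⇒2≤∣N∩D∣ : Cubic G → Unmatched G mat a → 2 ≤ ∣ N G a ∩ D ∣
    unmatched⇒2≤∣N∩D∣ {a = a} cubic a-unm = m+n≡3∧n≤1⇒2≤m split (∣p∣≤1 (N G a ∩ ∁ D) at-most-one)
      where
      split : ∣ N G a ∩ D ∣ + ∣ N G a ∩ ∁ D ∣ ≡ 3
      split = trans (sym (∣p∣≡∣p∩q∣+∣p∩∁q∣ (N G a) D)) (cubic a)
      partner : x ∈ N G a ∩ ∁ D → ∃ λ x′ → mat x x′ ≡ true × x′ ∈ N G a ∩ D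
      partner x∈ = let x∈N , x∈∁D = x∈p∩q⁻ (N G a) (∁ D) x∈ in
        unmatched-nbr∉D-partner a-unm (∈N⇒adjacent G x∈N) (x∈∁p⇒x∉p x∈∁D)
      at-most-one : x ∈ N G a ∩ ∁ D → y ∈ N G a ∩ ∁ D → x ≡ y
      at-most-one {x = x} {y = y} x∈ y∈ with x ≟ y | partner x∈ | partner y∈
      ... | yes x≡y | _ | _ = x≡y
      ... | no x≢y | x′ , xx′ , x′∈ | y′ , yy′ , y′∈ =
        contradiction (subst (4 ≤_) split (+-mono-≤ (x,y∈p⇒1<∣p∣ x′≢y′ x′∈ y′∈) (x,y∈p⇒1<∣p∣ x≢y x∈ y∈)))
                      1+n≰n
        where
        x′≢y′ : x′ ≢ y′
        x′≢y′ refl = x≢y (partner-injective xx′ yy′)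

    BadPair⇒2≤∣N∩D∣ : Cubic G → BadPair G D u v → 2 ≤ ∣ N G u ∩ D ∣
    BadPair⇒2≤∣N∩D∣ {u = u} {v = v} cubic (u≢v , u∉D , v∉D , same) with matched? u | matched? v
    ... | no u-unm | _ = unmatched⇒2≤∣N∩D∣ cubic u-unm
    ... | yes _ | no v-unm = subst (λ S → 2 ≤ ∣ S ∣) (sym same) (unmatched⇒2≤∣N∩D∣ cubic v-unm)
    ... | yes (u′ , uu′) | yes (v′ , vv′) =
      x,y∈p⇒1<∣p∣ (λ { refl → u≢v (partner-injective uu′ vv′) })
        (partner∈N∩D uu′ u∉D) (subst (v′ ∈_) (sym same) (partner∈N∩D vv′ v∉D))

    BadPair⇒∣N∩D∣≡2 : TwinFree G → Cubic G → BadPair G D u v → ∣ N G u ∩ D ∣ ≡ 2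
    BadPair⇒∣N∩D∣≡2 {u = u} twinFree cubic bad =
      ≤-antisym (≤-pred (≤∧≢⇒< ≤3 (BadPair⇒∣N∩D∣≢3 G D twinFree cubic bad))) (BadPair⇒2≤∣N∩D∣ cubic bad)
      where
      ≤3 : ∣ N G u ∩ D ∣ ≤ 3
      ≤3 = subst (∣ N G u ∩ D ∣ ≤_) (cubic u) (∣p∩q∣≤∣p∣ (N G u) D)

lemma2 : ∀ {n} (G : Graph n) → TwinFree G → Cubic G →
    (mat : Fin n → Fin n → Bool) → IsMaximumMatching G mat →
    (D : Subset n) → InDSet G mat D →
    ∀ u v → BadPair G D u v →
    (∣ N G u ∩ D ∣ ≡ 2) × (∣ N G v ∩ D ∣ ≡ 2)
lemma2 G twinFree cubic mat mm D D∈𝒟 u v bad =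
  BadPair⇒∣N∩D∣≡2 G mat mm D D∈𝒟 twinFree cubic bad ,
  BadPair⇒∣N∩D∣≡2 G mat mm D D∈𝒟 twinFree cubic (BadPair-sym G D bad)
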